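{- Let $A=(T,Q,q_0,Q_F,\to)$ be a nondeterministic finite automaton and let $F,F',G,G'\in BF_A$. If $F\Rightarrow F'$ and $G\Rightarrow G'$, then $F;G\Rightarrow F';G'$.
   Context: Boxes of $A$ are the subsets of $Q\times Q$; the set of boxes is $\mathcal{B}_A$. For boxes $\rho,\tau$, their relational composition is $\rho;\tau=\{(q,q''):\exists q'\in Q.\ (q,q')\in\rho,\ (q',q'')\in\tau\}$. $BF_A$ is the set of negation-free Boolean formulas whose atomic propositions are boxes, built with $\wedge$ and $\vee$, together with the constant $\mathit{false}$; conjunctions and disjunctions involving $\mathit{false}$ are simplified syntactically by $\mathit{false}\wedge F=F\wedge\mathit{false}=\mathit{false}$ and $\mathit{false}\vee F=F\vee\mathit{false}=F$, so $\mathit{false}$ is the only syntactic form of the unsatisfiable formula. Relational composition of formulas is defined by $F;\mathit{false}=\mathit{false};G=\mathit{false}$, for boxes by the composition above, and for composite formulas (with $\star\in\{\wedge,\vee\}$ and $\rho$ a box) by $(F_1\star F_2);G=(F_1;G)\star(F_2;G)$ and $\rho;(G_1\star G_2)=(\rho;G_1)\star(\rho;G_2)$. $F\Rightarrow G$ denotes semantic implication: every truth assignment to the boxes making $F$ true makes $G$ true. -}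

module Defs where

open import Data.Nat using (ℕ)
open import Data.Fin using (Fin; zero; suc)
open import Data.Bool using (Bool; true; false; _∧_; _∨_; T)
open import Data.Vec using (Vec; tabulate; lookup)
open import Data.Fin.Subset using (Subset)
open import Data.Product using (_×_; _,_)

record NFA : Set where
  field
    t       : ℕ
    n       : ℕ
    q₀      : Fin n
    final   : Subset n
    trans   : Fin n → Fin t → Fin n → Bool

-- Boxes: subsets of Q × Q, represented canonically as n×n Boolean matrices
-- (so equal sets are equal boxes).
Box : ℕ → Set
Box n = Vec (Vec Bool n) n

_∈ᵇ_ : ∀ {n} → Fin n × Fin n → Box n → Bool
_∈ᵇ_ (q , q') ρ = lookup (lookup ρ q) q'

anyFin : ∀ {n} → (Fin n → Bool) → Bool
anyFin {ℕ.zero}  f = false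
anyFin {ℕ.suc n} f = f zero ∨ anyFin (λ i → f (suc i))

_⨾ᵇ_ : ∀ {n} → Box n → Box n → Box n
ρ ⨾ᵇ τ = tabulate λ q → tabulate λ q'' →
  anyFin λ q' → lookup (lookup ρ q) q' ∧ lookup (lookup τ q') q''

data BF (n : ℕ) : Set where
  ff  : BF n
  box : Box n → BF n
  _∧ᶠ_ : BF n → BF n → BF n
  _∨ᶠ_ : BF n → BF n → BF n

-- smart constructors implementing the syntactic simplification of false
_∧ˢ_ : ∀ {n} → BF n → BF n → BF n
ff ∧ˢ G = ff
F  ∧ˢ ff = ff
F  ∧ˢ G = F ∧ᶠ G

_∨ˢ_ : ∀ {n} → BF n → BF n → BF n
ff ∨ˢ G = G
F  ∨ˢ ff = F
F  ∨ˢ G = F ∨ᶠ G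

_⨾_ : ∀ {n} → BF n → BF n → BF n
ff ⨾ G = ff
F ⨾ ff = ff
(F₁ ∧ᶠ F₂) ⨾ G = (F₁ ⨾ G) ∧ˢ (F₂ ⨾ G)
(F₁ ∨ᶠ F₂) ⨾ G = (F₁ ⨾ G) ∨ˢ (F₂ ⨾ G)
box ρ ⨾ (G₁ ∧ᶠ G₂) = (box ρ ⨾ G₁) ∧ˢ (box ρ ⨾ G₂)
box ρ ⨾ (G₁ ∨ᶠ G₂) = (box ρ ⨾ G₁) ∨ˢ (box ρ ⨾ G₂)
box ρ ⨾ box τ = box (ρ ⨾ᵇ τ)

⟦_⟧ : ∀ {n} → BF n → (Box n → Bool) → Bool
⟦ ff ⟧ v = false
⟦ box ρ ⟧ v = v ρ
⟦ F ∧ᶠ G ⟧ v = ⟦ F ⟧ v ∧ ⟦ G ⟧ v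
⟦ F ∨ᶠ G ⟧ v = ⟦ F ⟧ v ∨ ⟦ G ⟧ v

_⇒_ : ∀ {n} → BF n → BF n → Set
F ⇒ G = ∀ (v : Box _ → Bool) → T (⟦ F ⟧ v) → T (⟦ G ⟧ v)

-- Semantically, composing with G substitutes for each box ρ of F the formula
-- ρ ⨾ G, evaluated under v:  ⟦ F ⨾ G ⟧ v = ⟦ F ⟧ (ρ ↦ ⟦ G ⟧ (τ ↦ v (ρ ⨾ᵇ τ))).
-- Negation-free formulas are monotone in the assignment, so weakening G to G′
-- weakens the substituted assignment, and then F ⇒ F′ finishes the argument.
module Submission where

open import Defs
open import Data.Nat using (ℕ)
open import Data.Bool using (Bool; false; _∧_; _∨_; T)
open import Data.Bool.Properties using (∧-zeroʳ; ∨-identityʳ; T-∧; T-∨)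
open import Data.Product using (_,_)
open import Data.Sum using (inj₁; inj₂)
open import Function.Bundles using (Equivalence)
open import Relation.Binary.PropositionalEquality using (_≡_; refl; sym; trans; cong₂; subst)

private
  variable
    n : ℕ

⟦∧ˢ⟧ : (F G : BF n) (v : Box n → Bool) → ⟦ F ∧ˢ G ⟧ v ≡ ⟦ F ⟧ v ∧ ⟦ G ⟧ v
⟦∧ˢ⟧ ff        _         _ = refl
⟦∧ˢ⟧ (box _)   ff        _ = sym (∧-zeroʳ _)
⟦∧ˢ⟧ (_ ∧ᶠ _)  ff        _ = sym (∧-zeroʳ _)
⟦∧ˢ⟧ (_ ∨ᶠ _)  ff        _ = sym (∧-zeroʳ _)
⟦∧ˢ⟧ (box _)   (box _)   _ = refl
⟦∧ˢ⟧ (box _)   (_ ∧ᶠ _)  _ = refl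
⟦∧ˢ⟧ (box _)   (_ ∨ᶠ _)  _ = refl
⟦∧ˢ⟧ (_ ∧ᶠ _)  (box _)   _ = refl
⟦∧ˢ⟧ (_ ∧ᶠ _)  (_ ∧ᶠ _)  _ = refl
⟦∧ˢ⟧ (_ ∧ᶠ _)  (_ ∨ᶠ _)  _ = refl
⟦∧ˢ⟧ (_ ∨ᶠ _)  (box _)   _ = refl
⟦∧ˢ⟧ (_ ∨ᶠ _)  (_ ∧ᶠ _)  _ = refl
⟦∧ˢ⟧ (_ ∨ᶠ _)  (_ ∨ᶠ _)  _ = refl

⟦∨ˢ⟧ : (F G : BF n) (v : Box n → Bool) → ⟦ F ∨ˢ G ⟧ v ≡ ⟦ F ⟧ v ∨ ⟦ G ⟧ v
⟦∨ˢ⟧ ff        _         _ = refl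
⟦∨ˢ⟧ (box _)   ff        _ = sym (∨-identityʳ _)
⟦∨ˢ⟧ (_ ∧ᶠ _)  ff        _ = sym (∨-identityʳ _)
⟦∨ˢ⟧ (_ ∨ᶠ _)  ff        _ = sym (∨-identityʳ _)
⟦∨ˢ⟧ (box _)   (box _)   _ = refl
⟦∨ˢ⟧ (box _)   (_ ∧ᶠ _)  _ = refl
⟦∨ˢ⟧ (box _)   (_ ∨ᶠ _)  _ = refl
⟦∨ˢ⟧ (_ ∧ᶠ _)  (box _)   _ = refl
⟦∨ˢ⟧ (_ ∧ᶠ _)  (_ ∧ᶠ _)  _ = refl
⟦∨ˢ⟧ (_ ∧ᶠ _)  (_ ∨ᶠ _)  _ = refl
⟦∨ˢ⟧ (_ ∨ᶠ _)  (box _)   _ = refl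
⟦∨ˢ⟧ (_ ∨ᶠ _)  (_ ∧ᶠ _)  _ = refl
⟦∨ˢ⟧ (_ ∨ᶠ _)  (_ ∨ᶠ _)  _ = refl

⟦⟧-false : (F : BF n) → ⟦ F ⟧ (λ _ → false) ≡ false
⟦⟧-false ff       = refl
⟦⟧-false (box _)  = refl
⟦⟧-false (F ∧ᶠ G) = cong₂ _∧_ (⟦⟧-false F) (⟦⟧-false G)
⟦⟧-false (F ∨ᶠ G) = cong₂ _∨_ (⟦⟧-false F) (⟦⟧-false G)

⟦⟧-mono : (F : BF n) {v w : Box n → Bool} →
          (∀ ρ → T (v ρ) → T (w ρ)) → T (⟦ F ⟧ v) → T (⟦ F ⟧ w)
⟦⟧-mono (box ρ)  v⇒w Fv = v⇒w ρ Fv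
⟦⟧-mono (F ∧ᶠ G) v⇒w FGv with Equivalence.to T-∧ FGv
... | Fv , Gv = Equivalence.from T-∧ (⟦⟧-mono F v⇒w Fv , ⟦⟧-mono G v⇒w Gv)
⟦⟧-mono (F ∨ᶠ G) v⇒w FGv with Equivalence.to T-∨ FGv
... | inj₁ Fv = Equivalence.from T-∨ (inj₁ (⟦⟧-mono F v⇒w Fv))
... | inj₂ Gv = Equivalence.from T-∨ (inj₂ (⟦⟧-mono G v⇒w Gv))

⟦box⨾⟧ : (ρ : Box n) (G : BF n) (v : Box n → Bool) →
         ⟦ box ρ ⨾ G ⟧ v ≡ ⟦ G ⟧ (λ τ → v (ρ ⨾ᵇ τ))
⟦box⨾⟧ ρ ff         v = refl
⟦box⨾⟧ ρ (box τ)    v = refl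
⟦box⨾⟧ ρ (G₁ ∧ᶠ G₂) v =
  trans (⟦∧ˢ⟧ (box ρ ⨾ G₁) _ v) (cong₂ _∧_ (⟦box⨾⟧ ρ G₁ v) (⟦box⨾⟧ ρ G₂ v))
⟦box⨾⟧ ρ (G₁ ∨ᶠ G₂) v =
  trans (⟦∨ˢ⟧ (box ρ ⨾ G₁) _ v) (cong₂ _∨_ (⟦box⨾⟧ ρ G₁ v) (⟦box⨾⟧ ρ G₂ v))

⟦⨾⟧ : (F G : BF n) (v : Box n → Bool) →
      ⟦ F ⨾ G ⟧ v ≡ ⟦ F ⟧ (λ ρ → ⟦ G ⟧ (λ τ → v (ρ ⨾ᵇ τ)))
⟦⨾⟧ ff           G          v = refl
⟦⨾⟧ (box ρ)      G          v = ⟦box⨾⟧ ρ G v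
⟦⨾⟧ F@(_ ∧ᶠ _)   ff         v = sym (⟦⟧-false F)
⟦⨾⟧ F@(_ ∨ᶠ _)   ff         v = sym (⟦⟧-false F)
⟦⨾⟧ (F₁ ∧ᶠ F₂) G@(box _)  v = trans (⟦∧ˢ⟧ (F₁ ⨾ G) _ v) (cong₂ _∧_ (⟦⨾⟧ F₁ G v) (⟦⨾⟧ F₂ G v))
⟦⨾⟧ (F₁ ∧ᶠ F₂) G@(_ ∧ᶠ _) v = trans (⟦∧ˢ⟧ (F₁ ⨾ G) _ v) (cong₂ _∧_ (⟦⨾⟧ F₁ G v) (⟦⨾⟧ F₂ G v))
⟦⨾⟧ (F₁ ∧ᶠ F₂) G@(_ ∨ᶠ _) v = trans (⟦∧ˢ⟧ (F₁ ⨾ G) _ v) (cong₂ _∧_ (⟦⨾⟧ F₁ G v) (⟦⨾⟧ F₂ G v))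
⟦⨾⟧ (F₁ ∨ᶠ F₂) G@(box _)  v = trans (⟦∨ˢ⟧ (F₁ ⨾ G) _ v) (cong₂ _∨_ (⟦⨾⟧ F₁ G v) (⟦⨾⟧ F₂ G v))
⟦⨾⟧ (F₁ ∨ᶠ F₂) G@(_ ∧ᶠ _) v = trans (⟦∨ˢ⟧ (F₁ ⨾ G) _ v) (cong₂ _∨_ (⟦⨾⟧ F₁ G v) (⟦⨾⟧ F₂ G v))
⟦⨾⟧ (F₁ ∨ᶠ F₂) G@(_ ∨ᶠ _) v = trans (⟦∨ˢ⟧ (F₁ ⨾ G) _ v) (cong₂ _∨_ (⟦⨾⟧ F₁ G v) (⟦⨾⟧ F₂ G v))

lemma6 : (A : NFA) → (F F′ G G′ : BF (NFA.n A)) →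
    F ⇒ F′ → G ⇒ G′ → (F ⨾ G) ⇒ (F′ ⨾ G′)
lemma6 A F F′ G G′ F⇒F′ G⇒G′ v F⨾G =
  subst T (sym (⟦⨾⟧ F′ G′ v))
    (⟦⟧-mono F′ (λ ρ → G⇒G′ (λ τ → v (ρ ⨾ᵇ τ)))
      (F⇒F′ _ (subst T (⟦⨾⟧ F G v) F⨾G)))
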